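{- Let $q=p^f=2n+1\ge 5$ be an odd prime power with $p$ prime and $f\in\mathbb{Z}^+$, and let $s_1=1,s_2,\dots,s_n$ be an enumeration of the nonzero squares of $\mathbb{F}_q$ with $s_1=1$. Then, in $\mathbb{F}_q$, $$(-1)^{\frac{(n-1)(n-2)}{2}}\prod_{2\le i<j\le n}(s_j-s_i)^2=\left(-\frac12\right)^{n-2}\in\mathbb{F}_p.$$ -}

module Defs where

open import Level using (Level; _⊔_)
open import Algebra.Bundles using (CommutativeRing)
open import Data.Nat as ℕ using (ℕ; zero; suc)
open import Data.Fin using (Fin; toℕ)
import Data.Fin as Fin
open import Data.Bool using (if_then_else_; _∧_)
open import Data.Product using (∃; _,_)
open import Relation.Binary.PropositionalEquality using (_≡_)
open import Relation.Nullary using (¬_)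
open import Relation.Nullary.Decidable using (⌊_⌋)

module _ {c ℓ : Level} (R : CommutativeRing c ℓ) where
  open CommutativeRing R

  -- A field structure on a commutative ring: 0 ≠ 1 and every nonzero
  -- element has a multiplicative inverse (given as a total function,
  -- whose value at 0 is irrelevant).
  record IsField : Set (c ⊔ ℓ) where
    field
      _⁻¹      : Carrier → Carrier
      0≉1      : ¬ (0# ≈ 1#)
      ⁻¹-inverse : ∀ x → ¬ (x ≈ 0#) → (x * (x ⁻¹)) ≈ 1#

  record HasCardinality (q : ℕ) : Set (c ⊔ ℓ) where
    field
      elem       : Fin q → Carrier
      injective  : ∀ a b → elem a ≈ elem b → a ≡ b
      surjective : ∀ x → ∃ λ a → elem a ≈ x

  IsSquare : Carrier → Set (c ⊔ ℓ)
  IsSquare x = ∃ λ y → (y * y) ≈ x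

  pow : Carrier → ℕ → Carrier
  pow x zero    = 1#
  pow x (suc k) = x * pow x k

  ∏ : ∀ {m} → (Fin m → Carrier) → Carrier
  ∏ {zero}  g = 1#
  ∏ {suc m} g = g Fin.zero * ∏ (λ i → g (Fin.suc i))

  -- For an enumeration s : Fin n → Carrier (0-based, so s at index 0 is s₁),
  -- the product  ∏_{2 ≤ i < j ≤ n} (s_j − s_i)²  (1-based indices), i.e.
  -- over 0-based indices 1 ≤ i < j ≤ n − 1.
  discProd : ∀ {n} → (Fin n → Carrier) → Carrier
  discProd s =
    ∏ (λ j → ∏ (λ i →
      if ⌊ 1 ℕ.≤? toℕ i ⌋ ∧ ⌊ toℕ i ℕ.<? toℕ j ⌋
      then (s j - s i) * (s j - s i)
      else 1#))

{-# OPTIONS --safe #-}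
-- The nonzero squares form a subgroup of order n of K×, so multiplication by
-- any s i permutes them and s i ^ n = 1; likewise translation by 1 permutes
-- the q elements of K, so (2n + 1)·1 = 0, i.e. n·1 = -1/2.  As n distinct
-- roots of xⁿ - 1, the s i make the monic polynomial ∏_{i ≠ j} (x - s i) of
-- degree n - 1 equal to (xⁿ - s jⁿ)/(x - s j), since both vanish at the n - 1
-- points s i, i ≠ j.  Evaluating at x = s j, at x = 0 and at x = s₁ = 1 gives
-- ∏_{i ≠ j} (s j - s i) = n·s jⁿ⁻¹, ∏_{i ≥ 2} s i = (-1)ⁿ⁻¹ and
-- ∏_{i ≥ 2} (1 - s i) = n, so the product of s j - s i over the ordered pairs
-- i ≠ j of indices ≥ 2 is nⁿ⁻².  Pairing (i, j) with (j, i) shows that this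
-- product is (-1)^C(n-1,2) ∏_{2 ≤ i < j} (s j - s i)².
module Submission where

open import Algebra.Bundles using (CommutativeRing)
open import Algebra.Definitions using (Congruent₁; AlmostLeftCancellative)
import Algebra.Properties.AbelianGroup as AbelianGroupProperties
import Algebra.Properties.CommutativeMonoid.Sum as CommutativeMonoidSum
import Algebra.Properties.Group as GroupProperties
import Algebra.Properties.Ring as RingProperties
import Algebra.Properties.Semiring.Exp as SemiringExp
import Algebra.Properties.Semiring.Mult as SemiringMult
import Algebra.Solver.Ring.NaturalCoefficients.Default as SemiringSolver
open import Data.Bool using (if_then_else_; _∧_)
open import Data.Fin using (Fin; zero; suc; toℕ; punchIn)
open import Data.Fin.Permutation using (Permutation; permutation; _⟨$⟩ʳ_)
open import Data.Fin.Properties using (0≢1+n; suc-injective; punchIn-injective; punchInᵢ≢i)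
import Data.Nat as ℕ
open import Data.Nat using (ℕ; zero; suc)
open import Data.Nat.Combinatorics using (_C_; nC1≡n; nCk+nC[k+1]≡[n+1]C[k+1])
open import Data.Nat.DivMod using (m*n/n≡m)
import Data.Nat.Properties as ℕₚ
open import Data.Product using (Σ; ∃; _×_; _,_; proj₁; proj₂)
open import Data.Unit using (⊤; tt)
open import Level using (_⊔_)
open import Relation.Binary.PropositionalEquality as ≡ using (_≡_)
open import Relation.Nullary using (¬_)
open import Relation.Nullary.Decidable using (⌊_⌋; isYes≗does)

open import Defs

[1+m]C2≡m+mC2 : ∀ m → suc m C 2 ≡ m ℕ.+ m C 2
[1+m]C2≡m+mC2 m = ≡.trans (≡.sym (nCk+nC[k+1]≡[n+1]C[k+1] m 1)) (≡.cong (ℕ._+ m C 2) (nC1≡n m))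

[1+m]C2*2≡[1+m]*m : ∀ m → (suc m C 2) ℕ.* 2 ≡ suc m ℕ.* m
[1+m]C2*2≡[1+m]*m zero    = ≡.refl
[1+m]C2*2≡[1+m]*m (suc m) = begin
  (suc (suc m) C 2) * 2        ≡⟨ ≡.cong (_* 2) ([1+m]C2≡m+mC2 (suc m)) ⟩
  (suc m + suc m C 2) * 2      ≡⟨ ℕₚ.*-distribʳ-+ 2 (suc m) (suc m C 2) ⟩
  suc m * 2 + (suc m C 2) * 2  ≡⟨ ≡.cong (suc m * 2 +_) ([1+m]C2*2≡[1+m]*m m) ⟩
  suc m * 2 + suc m * m        ≡⟨ ℕₚ.*-distribˡ-+ (suc m) 2 m ⟨
  suc m * suc (suc m)          ≡⟨ ℕₚ.*-comm (suc m) (suc (suc m)) ⟩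
  suc (suc m) * suc m          ∎
  where open Data.Nat using (_+_; _*_); open ≡.≡-Reasoning

[1+m]*m/2≡[1+m]C2 : ∀ m → (suc m ℕ.* m) ℕ./ 2 ≡ suc m C 2
[1+m]*m/2≡[1+m]C2 m =
  ≡.trans (≡.cong (ℕ._/ 2) (≡.sym ([1+m]C2*2≡[1+m]*m m))) (m*n/n≡m (suc m C 2) 2)

⌊1+m<?1+n⌋≡⌊m<?n⌋ : ∀ m n → ⌊ suc m ℕ.<? suc n ⌋ ≡ ⌊ m ℕ.<? n ⌋
⌊1+m<?1+n⌋≡⌊m<?n⌋ m n = ≡.trans (isYes≗does (suc m ℕ.<? suc n)) (≡.sym (isYes≗does (m ℕ.<? n)))

module _ {c ℓ} (R : CommutativeRing c ℓ) where
  open CommutativeRing R hiding (zero)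
  open import Relation.Binary.Reasoning.Setoid setoid
  open RingProperties ring using (-1*x≈-x; -‿distribʳ-*)
  open AbelianGroupProperties +-abelianGroup using (⁻¹-anti-homo‿-; xyx⁻¹≈y)
  open GroupProperties +-group
    using (identityʳ-unique; inverseˡ-unique; x∙y⁻¹≈ε⇒x≈y; ∙-cancelˡ; //-rightDividesˡ; //-rightDividesʳ)
  open SemiringExp semiring using (_^_; ^-congˡ; ^-homo-*)
  open SemiringMult semiring
    using (×-homo-+; ×1-homo-*; ×-comm-*; ×-assoc-*; ×-congʳ) renaming (_×_ to _·_)
  open SemiringSolver commutativeSemiring using (solve; _:+_; _:*_; _:=_)
  open CommutativeMonoidSum *-commutativeMonoid using () renaming
    ( sum to product; sum-cong-≋ to product-cong; sum-cong-≗ to product-cong-≗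
    ; ∑-distrib-+ to product-distrib; sum-replicate to product-const
    ; sum-replicate-zero to product-ones; sum-permute to product-permute
    ; sum-remove to product-remove
    )

  pow≡^ : ∀ x k → pow R x k ≡ x ^ k
  pow≡^ x zero    = ≡.refl
  pow≡^ x (suc k) = ≡.cong (x *_) (pow≡^ x k)

  ∏≡product : ∀ {m} (f : Fin m → Carrier) → ∏ R f ≡ product f
  ∏≡product {zero}  f = ≡.refl
  ∏≡product {suc m} f = ≡.cong (f zero *_) (∏≡product (λ i → f (suc i)))

  1^≈1 : ∀ k → 1# ^ k ≈ 1#
  1^≈1 k = trans (sym (product-const k)) (product-ones k)

  product-neg : ∀ {m} (f : Fin m → Carrier) → product (λ i → - f i) ≈ (- 1#) ^ m * product f
  product-neg {m} f = begin
    product (λ i → - f i)                 ≈⟨ product-cong (λ i → sym (-1*x≈-x (f i))) ⟩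
    product (λ i → - 1# * f i)            ≈⟨ product-distrib (λ _ → - 1#) f ⟩
    product {m} (λ _ → - 1#) * product f  ≈⟨ *-congʳ (product-const m) ⟩
    (- 1#) ^ m * product f                ∎

  product≈0 : ∀ {m} (f : Fin m → Carrier) i → f i ≈ 0# → product f ≈ 0#
  product≈0 {suc m} f i fᵢ≈0 = trans (product-remove {i = i} f) (trans (*-congʳ fᵢ≈0) (zeroˡ _))

  -- Polynomial functions rather than coefficient lists, in Horner form.
  HasDegree< : ℕ → (Carrier → Carrier) → Set (c ⊔ ℓ)
  HasDegree< zero    f = ∀ x → f x ≈ 0#
  HasDegree< (suc k) f = Σ Carrier λ a → Σ (Carrier → Carrier) λ g →
    HasDegree< k g × (∀ x → f x ≈ a + x * g x)

  deg<-+ : ∀ {k f g} → HasDegree< k f → HasDegree< k g → HasDegree< k (λ x → f x + g x)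
  deg<-+ {zero} f≈0 g≈0 x = trans (+-cong (f≈0 x) (g≈0 x)) (+-identityʳ 0#)
  deg<-+ {suc k} (a , f′ , f′< , f≈) (b , g′ , g′< , g≈) =
    a + b , (λ x → f′ x + g′ x) , deg<-+ f′< g′< , λ x →
      trans (+-cong (f≈ x) (g≈ x))
            (solve 5 (λ a b x u v → (a :+ x :* u) :+ (b :+ x :* v) := (a :+ b) :+ x :* (u :+ v))
                   refl a b x (f′ x) (g′ x))

  deg<-scale : ∀ {k f} a → HasDegree< k f → HasDegree< k (λ x → a * f x)
  deg<-scale {zero} a f≈0 x = trans (*-congˡ (f≈0 x)) (zeroʳ a)
  deg<-scale {suc k} a (b , g , g< , f≈) =
    a * b , (λ x → a * g x) , deg<-scale a g< , λ x →
      trans (*-congˡ (f≈ x))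
            (solve 4 (λ a b x u → a :* (b :+ x :* u) := a :* b :+ x :* (a :* u)) refl a b x (g x))

  deg<-x* : ∀ {k f} → HasDegree< k f → HasDegree< (suc k) (λ x → x * f x)
  deg<-x* {f = f} f< = 0# , f , f< , λ x → sym (+-identityˡ _)

  deg<-suc : ∀ {k f} → HasDegree< k f → HasDegree< (suc k) f
  deg<-suc {zero} f≈0 = 0# , (λ _ → 0#) , (λ _ → refl) , λ x →
    trans (f≈0 x) (sym (trans (+-congˡ (zeroʳ x)) (+-identityʳ 0#)))
  deg<-suc {suc k} (a , g , g< , f≈) = a , g , deg<-suc g< , f≈

  ^-deg< : ∀ k → HasDegree< (suc k) (_^ k)
  ^-deg< zero    = 1# , (λ _ → 0#) , (λ _ → refl) , λ x → sym (trans (+-congˡ (zeroʳ x)) (+-identityʳ 1#))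
  ^-deg< (suc k) = deg<-x* (^-deg< k)

  -- Writing x as y + (x - y) turns the identities with subtraction below into
  -- semiring identities in y and x - y.
  x≈y+[x-y] : ∀ x y → x ≈ y + (x - y)
  x≈y+[x-y] x y = sym (trans (sym (+-assoc y x (- y))) (xyx⁻¹≈y y x))

  deg<-quotient : ∀ {k f} → HasDegree< (suc k) f → ∀ a →
                  Σ (Carrier → Carrier) λ q → HasDegree< k q × (∀ x → f x ≈ f a + (x - a) * q x)
  deg<-quotient {zero} {f} (b , g , g≈0 , f≈) a = (λ _ → 0#) , (λ _ → refl) , λ x → begin
    f x                 ≈⟨ f≈b x ⟩
    b                   ≈⟨ f≈b a ⟨
    f a                 ≈⟨ +-identityʳ (f a) ⟨
    f a + 0#            ≈⟨ +-congˡ (zeroʳ (x - a)) ⟨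
    f a + (x - a) * 0#  ∎
    where
    f≈b : ∀ x → f x ≈ b
    f≈b x = trans (f≈ x) (trans (+-congˡ (trans (*-congˡ (g≈0 x)) (zeroʳ x))) (+-identityʳ b))
  deg<-quotient {suc k} {f} (b , g , g< , f≈) a with deg<-quotient g< a
  ... | q , q< , g≈ = (λ x → g x + a * q x) , deg<-+ g< (deg<-scale a (deg<-suc q<)) , λ x → begin
    f x                                                          ≈⟨ f≈ x ⟩
    b + x * g x                                                  ≈⟨ +-congˡ (*-cong (x≈y+[x-y] x a) (g≈ x)) ⟩
    b + (a + (x - a)) * (g a + (x - a) * q x)
      ≈⟨ solve 5 (λ b a d G Q → b :+ (a :+ d) :* (G :+ d :* Q) := (b :+ a :* G) :+ d :* ((G :+ d :* Q) :+ a :* Q))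
               refl b a (x - a) (g a) (q x) ⟩
    (b + a * g a) + (x - a) * ((g a + (x - a) * q x) + a * q x)  ≈⟨ +-cong (f≈ a) (*-congˡ (+-congʳ (g≈ x))) ⟨
    f a + (x - a) * (g x + a * q x)                              ∎

  Monic : ℕ → (Carrier → Carrier) → Set (c ⊔ ℓ)
  Monic k f = Σ (Carrier → Carrier) λ r → HasDegree< k r × (∀ x → f x ≈ x ^ k + r x)

  monic-[x-a]* : ∀ {k f} a → Monic k f → Monic (suc k) (λ x → (x - a) * f x)
  monic-[x-a]* {k} a (r , r< , f≈) =
    (λ x → x * r x + (- a) * (x ^ k + r x)) ,
    deg<-+ (deg<-x* r<) (deg<-scale (- a) (deg<-+ (^-deg< k) (deg<-suc r<))) ,
    λ x → trans (*-congˡ (f≈ x))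
      (solve 4 (λ x b p u → (x :+ b) :* (p :+ u) := x :* p :+ (x :* u :+ b :* (p :+ u)))
             refl x (- a) (x ^ k) (r x))

  monic-product : ∀ {m} (a : Fin m → Carrier) → Monic m (λ x → product (λ i → x - a i))
  monic-product {zero}  a = (λ _ → 0#) , (λ _ → refl) , λ x → sym (+-identityʳ 1#)
  monic-product {suc m} a = monic-[x-a]* (a zero) (monic-product (λ i → a (suc i)))

  powQuotient : ℕ → Carrier → Carrier → Carrier
  powQuotient zero    x t = 0#
  powQuotient (suc k) x t = t ^ k + x * powQuotient k x t

  powQuotient-spec : ∀ k x t → x ^ k ≈ t ^ k + (x - t) * powQuotient k x t
  powQuotient-spec zero    x t = sym (trans (+-congˡ (zeroʳ (x - t))) (+-identityʳ 1#))
  powQuotient-spec (suc k) x t = begin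
    x * x ^ k                                  ≈⟨ *-congˡ (powQuotient-spec k x t) ⟩
    x * (t ^ k + (x - t) * Q)                  ≈⟨ solve 4 (λ x d T Q → x :* (T :+ d :* Q) := x :* T :+ d :* (x :* Q))
                                                        refl x (x - t) (t ^ k) Q ⟩
    x * t ^ k + (x - t) * (x * Q)              ≈⟨ +-congʳ (*-congʳ (x≈y+[x-y] x t)) ⟩
    (t + (x - t)) * t ^ k + (x - t) * (x * Q)  ≈⟨ solve 4 (λ t d T E → (t :+ d) :* T :+ d :* E := t :* T :+ d :* (T :+ E))
                                                        refl t (x - t) (t ^ k) (x * Q) ⟩
    t * t ^ k + (x - t) * (t ^ k + x * Q)      ∎
    where
    Q : Carrier
    Q = powQuotient k x t

  powQuotient-monic : ∀ k t → Monic k (λ x → powQuotient (suc k) x t)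
  powQuotient-monic zero    t = (λ _ → 0#) , (λ _ → refl) , λ x → +-congˡ (zeroʳ x)
  powQuotient-monic (suc k) t with powQuotient-monic k t
  ... | r , r< , Q≈ = (λ x → t ^ suc k + x * r x) , (t ^ suc k , r , r< , λ _ → refl) , λ x → begin
    t ^ suc k + x * powQuotient (suc k) x t  ≈⟨ +-congˡ (*-congˡ (Q≈ x)) ⟩
    t ^ suc k + x * (x ^ k + r x)            ≈⟨ solve 4 (λ T x p u → T :+ x :* (p :+ u) := x :* p :+ (T :+ x :* u))
                                                      refl (t ^ suc k) x (x ^ k) (r x) ⟩
    x * x ^ k + (t ^ suc k + x * r x)        ∎

  powQuotient-diagonal : ∀ k t → powQuotient (suc k) t t ≈ suc k · t ^ k
  powQuotient-diagonal zero    t = +-congˡ (zeroʳ t)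
  powQuotient-diagonal (suc k) t =
    +-congˡ (trans (*-congˡ (powQuotient-diagonal k t)) (×-comm-* (suc k) t (t ^ k)))

  powQuotient-at-0 : ∀ k t → powQuotient (suc k) 0# t ≈ t ^ k
  powQuotient-at-0 k t = trans (+-congˡ (zeroˡ _)) (+-identityʳ _)

  discriminant : ∀ {m} → (Fin m → Carrier) → Carrier
  discriminant t = product λ j → product λ i →
    if ⌊ toℕ i ℕ.<? toℕ j ⌋ then (t j - t i) * (t j - t i) else 1#

  orderedDiffs : ∀ {k} → (Fin (suc k) → Carrier) → Carrier
  orderedDiffs t = product λ j → product λ i → t j - t (punchIn j i)

  discProd≈discriminant : ∀ {m} (s : Fin (suc m) → Carrier) → discProd R s ≈ discriminant (λ i → s (suc i))
  discProd≈discriminant {m} s = begin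
    discProd R s                                                ≡⟨ ∏∏≡product-product ⟩
    product (row zero) * product (λ j → product (row (suc j)))
      ≈⟨ *-cong (trans (product-cong row₀≈1) (product-ones (suc m))) (product-cong row₊≈) ⟩
    1# * discriminant (λ i → s (suc i))                         ≈⟨ *-identityˡ _ ⟩
    discriminant (λ i → s (suc i))                              ∎
    where
    sq : Fin (suc m) → Fin (suc m) → Carrier
    sq j i = (s j - s i) * (s j - s i)
    row : Fin (suc m) → Fin (suc m) → Carrier
    row j i = if ⌊ 1 ℕ.≤? toℕ i ⌋ ∧ ⌊ toℕ i ℕ.<? toℕ j ⌋ then sq j i else 1#
    row₀≈1 : ∀ i → row zero i ≈ 1#
    row₀≈1 zero    = refl
    row₀≈1 (suc i) = refl
    row₊≈ : ∀ j → product (row (suc j)) ≈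
                  product (λ i → if ⌊ toℕ i ℕ.<? toℕ j ⌋ then sq (suc j) (suc i) else 1#)
    row₊≈ j = trans (*-identityˡ _) (product-cong λ i →
      reflexive (≡.cong (λ b → if b then sq (suc j) (suc i) else 1#) (⌊1+m<?1+n⌋≡⌊m<?n⌋ (toℕ i) (toℕ j))))
    ∏∏≡product-product : ∏ R (λ j → ∏ R (row j)) ≡ product (λ j → product (row j))
    ∏∏≡product-product =
      ≡.trans (∏≡product (λ j → ∏ R (row j))) (product-cong-≗ (λ j → ∏≡product (row j)))

  discriminant-suc : ∀ {k} (t : Fin (suc k) → Carrier) →
    discriminant t ≈
    (product (λ j → t (suc j) - t zero) * product (λ j → t (suc j) - t zero)) * discriminant (λ i → t (suc i))
  discriminant-suc {k} t = begin
    discriminant t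
      ≈⟨ *-cong (product-ones (suc k)) (product-cong λ j → *-congˡ (product-cong λ i →
           reflexive (≡.cong (λ b → if b then sq (suc j) (suc i) else 1#) (⌊1+m<?1+n⌋≡⌊m<?n⌋ (toℕ i) (toℕ j))))) ⟩
    1# * product (λ j → sq (suc j) zero * row′ j)                  ≈⟨ *-identityˡ _ ⟩
    product (λ j → sq (suc j) zero * row′ j)                       ≈⟨ product-distrib (λ j → sq (suc j) zero) row′ ⟩
    product (λ j → sq (suc j) zero) * discriminant (λ i → t (suc i))
      ≈⟨ *-congʳ (product-distrib (λ j → t (suc j) - t zero) (λ j → t (suc j) - t zero)) ⟩
    (product (λ j → t (suc j) - t zero) * product (λ j → t (suc j) - t zero)) * discriminant (λ i → t (suc i)) ∎
    where
    sq : Fin (suc k) → Fin (suc k) → Carrier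
    sq j i = (t j - t i) * (t j - t i)
    row′ : Fin k → Carrier
    row′ j = product (λ i → if ⌊ toℕ i ℕ.<? toℕ j ⌋ then sq (suc j) (suc i) else 1#)

  orderedDiffs-suc : ∀ {k} (t : Fin (suc (suc k)) → Carrier) →
    orderedDiffs t ≈
    product (λ i → t zero - t (suc i)) * (product (λ j → t (suc j) - t zero) * orderedDiffs (λ i → t (suc i)))
  orderedDiffs-suc t =
    *-congˡ (product-distrib (λ j → t (suc j) - t zero) (λ j → product λ i → t (suc j) - t (suc (punchIn j i))))

  orderedDiffs≈±discriminant : ∀ k (t : Fin (suc k) → Carrier) →
                               orderedDiffs t ≈ (- 1#) ^ (suc k C 2) * discriminant t
  orderedDiffs≈±discriminant zero    t = sym (*-congˡ (trans (*-identityʳ _) (*-identityʳ _)))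
  orderedDiffs≈±discriminant (suc k) t = begin
    orderedDiffs t                                      ≈⟨ orderedDiffs-suc t ⟩
    A * (B * orderedDiffs t′)
      ≈⟨ *-cong A≈±B (*-congˡ (orderedDiffs≈±discriminant k t′)) ⟩
    ((- 1#) ^ suc k * B) * (B * (σ * discriminant t′))
      ≈⟨ solve 4 (λ u b σ d → (u :* b) :* (b :* (σ :* d)) := (u :* σ) :* ((b :* b) :* d))
               refl ((- 1#) ^ suc k) B σ (discriminant t′) ⟩
    ((- 1#) ^ suc k * σ) * ((B * B) * discriminant t′)
      ≈⟨ *-cong (^-homo-* (- 1#) (suc k) (suc k C 2)) (discriminant-suc t) ⟨
    (- 1#) ^ (suc k ℕ.+ suc k C 2) * discriminant t
      ≡⟨ ≡.cong (λ e → (- 1#) ^ e * discriminant t) ([1+m]C2≡m+mC2 (suc k)) ⟨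
    (- 1#) ^ (suc (suc k) C 2) * discriminant t            ∎
    where
    t′ : Fin (suc k) → Carrier
    t′ i = t (suc i)
    A B σ : Carrier
    A = product (λ i → t zero - t (suc i))
    B = product (λ j → t (suc j) - t zero)
    σ = (- 1#) ^ (suc k C 2)
    A≈±B : A ≈ (- 1#) ^ suc k * B
    A≈±B = trans (product-cong λ i → sym (⁻¹-anti-homo‿- (t (suc i)) (t zero)))
                 (product-neg (λ j → t (suc j) - t zero))

  permutation-of-enumeration :
    ∀ {p n} {P : Carrier → Set p} (e : Fin n → Carrier) →
    (∀ a b → e a ≈ e b → a ≡ b) → (∀ x → P x → ∃ λ a → e a ≈ x) → (∀ a → P (e a)) →
    (φ ψ : Carrier → Carrier) → Congruent₁ _≈_ φ → Congruent₁ _≈_ ψ →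
    (∀ x → P x → P (φ x)) → (∀ x → P x → P (ψ x)) →
    (∀ x → φ (ψ x) ≈ x) → (∀ x → ψ (φ x) ≈ x) →
    Σ (Permutation n n) λ π → ∀ a → e (π ⟨$⟩ʳ a) ≈ φ (e a)
  permutation-of-enumeration {n = n} e e-injective e-onto e-into φ ψ φ-cong ψ-cong φ-into ψ-into φψ ψφ =
    permutation to from to∘from from∘to , e∘to
    where
    to from : Fin n → Fin n
    to   a = proj₁ (e-onto (φ (e a)) (φ-into _ (e-into a)))
    from a = proj₁ (e-onto (ψ (e a)) (ψ-into _ (e-into a)))
    e∘to : ∀ a → e (to a) ≈ φ (e a)
    e∘to a = proj₂ (e-onto (φ (e a)) (φ-into _ (e-into a)))
    e∘from : ∀ a → e (from a) ≈ ψ (e a)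
    e∘from a = proj₂ (e-onto (ψ (e a)) (ψ-into _ (e-into a)))
    to∘from : ∀ a → to (from a) ≡ a
    to∘from a = e-injective _ _ (trans (e∘to (from a)) (trans (φ-cong (e∘from a)) (φψ (e a))))
    from∘to : ∀ a → from (to a) ≡ a
    from∘to a = e-injective _ _ (trans (e∘from (to a)) (trans (ψ-cong (e∘to a)) (ψφ (e a))))

  cardinality·1≈0 : ∀ {q} → HasCardinality R q → q · 1# ≈ 0#
  cardinality·1≈0 {q} card = identityʳ-unique (sum elem) (q · 1#) (begin
    sum elem + q · 1#               ≈⟨ +-congˡ (sum-replicate q) ⟨
    sum elem + sum {q} (λ _ → 1#)   ≈⟨ ∑-distrib-+ elem (λ _ → 1#) ⟨
    sum (λ a → elem a + 1#)         ≈⟨ sum-cong-≋ (λ a → sym (proj₂ shift a)) ⟩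
    sum (λ a → elem (π ⟨$⟩ʳ a))     ≈⟨ sum-permute elem π ⟨
    sum elem                        ∎)
    where
    open HasCardinality card
    open CommutativeMonoidSum +-commutativeMonoid using (sum; sum-replicate; ∑-distrib-+; sum-cong-≋; sum-permute)
    shift : Σ (Permutation q q) λ π → ∀ a → elem (π ⟨$⟩ʳ a) ≈ elem a + 1#
    shift = permutation-of-enumeration {P = λ _ → ⊤} elem injective (λ x _ → surjective x) (λ _ → tt)
      (_+ 1#) (_- 1#) +-congʳ +-congʳ _ _ (//-rightDividesˡ 1#) (//-rightDividesʳ 1#)
    π : Permutation q q
    π = proj₁ shift

  module _ (F : IsField R) where
    open IsField F using (_⁻¹; 0≉1; ⁻¹-inverse)

    1≉0 : ¬ 1# ≈ 0#
    1≉0 1≈0 = 0≉1 (sym 1≈0)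

    *-cancelˡ-nonzero : AlmostLeftCancellative _≈_ 0# _*_
    *-cancelˡ-nonzero x y z x≉0 xy≈xz = begin
      y               ≈⟨ *-identityˡ y ⟨
      1# * y          ≈⟨ *-congʳ x⁻¹x≈1 ⟨
      (x ⁻¹ * x) * y  ≈⟨ *-assoc _ _ _ ⟩
      x ⁻¹ * (x * y)  ≈⟨ *-congˡ xy≈xz ⟩
      x ⁻¹ * (x * z)  ≈⟨ *-assoc _ _ _ ⟨
      (x ⁻¹ * x) * z  ≈⟨ *-congʳ x⁻¹x≈1 ⟩
      1# * z          ≈⟨ *-identityˡ z ⟩
      z               ∎
      where
      x⁻¹x≈1 : x ⁻¹ * x ≈ 1#
      x⁻¹x≈1 = trans (*-comm _ _) (⁻¹-inverse x x≉0)

    x*y≈0⇒y≈0 : ∀ {x y} → ¬ x ≈ 0# → x * y ≈ 0# → y ≈ 0#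
    x*y≈0⇒y≈0 {x} {y} x≉0 xy≈0 = *-cancelˡ-nonzero x y 0# x≉0 (trans xy≈0 (sym (zeroʳ x)))

    *-nonzero : ∀ {x y} → ¬ x ≈ 0# → ¬ y ≈ 0# → ¬ x * y ≈ 0#
    *-nonzero x≉0 y≉0 xy≈0 = y≉0 (x*y≈0⇒y≈0 x≉0 xy≈0)

    product-nonzero : ∀ {m} (f : Fin m → Carrier) → (∀ i → ¬ f i ≈ 0#) → ¬ product f ≈ 0#
    product-nonzero {zero}  f f≉0 = 1≉0
    product-nonzero {suc m} f f≉0 =
      *-nonzero (f≉0 zero) (product-nonzero (λ i → f (suc i)) (λ i → f≉0 (suc i)))

    deg<-agree : ∀ {k f g} → HasDegree< k f → HasDegree< k g →
                 (a : Fin k → Carrier) → (∀ i j → a i ≈ a j → i ≡ j) → (∀ i → f (a i) ≈ g (a i)) →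
                 ∀ x → f x ≈ g x
    deg<-agree {zero} f≈0 g≈0 a a-injective f≈g x = trans (f≈0 x) (sym (g≈0 x))
    deg<-agree {suc k} {f} {g} f< g< a a-injective f≈g x
      with deg<-quotient f< (a zero) | deg<-quotient g< (a zero)
    ... | qf , qf< , f≈ | qg , qg< , g≈ = begin
      f x                     ≈⟨ f≈ x ⟩
      f a₀ + (x - a₀) * qf x
        ≈⟨ +-cong (f≈g zero) (*-congˡ (deg<-agree qf< qg< (λ i → a (suc i)) a′-injective qf≈qg x)) ⟩
      g a₀ + (x - a₀) * qg x  ≈⟨ g≈ x ⟨
      g x                     ∎
      where
      a₀ : Carrier
      a₀ = a zero
      a′-injective : ∀ i j → a (suc i) ≈ a (suc j) → i ≡ j
      a′-injective i j aᵢ≈aⱼ = suc-injective (a-injective _ _ aᵢ≈aⱼ)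
      qf≈qg : ∀ i → qf (a (suc i)) ≈ qg (a (suc i))
      qf≈qg i = *-cancelˡ-nonzero (y - a₀) _ _ y-a₀≉0 (∙-cancelˡ (f a₀) _ _ (begin
        f a₀ + (y - a₀) * qf y  ≈⟨ f≈ y ⟨
        f y                     ≈⟨ f≈g (suc i) ⟩
        g y                     ≈⟨ g≈ y ⟩
        g a₀ + (y - a₀) * qg y  ≈⟨ +-congʳ (f≈g zero) ⟨
        f a₀ + (y - a₀) * qg y  ∎))
        where
        y : Carrier
        y = a (suc i)
        y-a₀≉0 : ¬ y - a₀ ≈ 0#
        y-a₀≉0 y-a₀≈0 = 0≢1+n (≡.sym (a-injective _ _ (x∙y⁻¹≈ε⇒x≈y _ _ y-a₀≈0)))

    monic-agree : ∀ {k f g} → Monic k f → Monic k g →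
                  (a : Fin k → Carrier) → (∀ i j → a i ≈ a j → i ≡ j) → (∀ i → f (a i) ≈ g (a i)) →
                  ∀ x → f x ≈ g x
    monic-agree {k} {f} {g} (rf , rf< , f≈) (rg , rg< , g≈) a a-injective f≈g x = begin
      f x           ≈⟨ f≈ x ⟩
      x ^ k + rf x  ≈⟨ +-congˡ (deg<-agree rf< rg< a a-injective rf≈rg x) ⟩
      x ^ k + rg x  ≈⟨ g≈ x ⟨
      g x           ∎
      where
      rf≈rg : ∀ i → rf (a i) ≈ rg (a i)
      rf≈rg i = ∙-cancelˡ (a i ^ k) _ _ (trans (sym (f≈ (a i))) (trans (f≈g i) (g≈ (a i))))

    scaling-invariant⇒^≈1 :
      ∀ {p n} {P : Carrier → Set p} (e : Fin n → Carrier) →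
      (∀ a b → e a ≈ e b → a ≡ b) → (∀ x → P x → ∃ λ a → e a ≈ x) → (∀ a → P (e a)) →
      (∀ a → ¬ e a ≈ 0#) →
      ∀ x y → x * y ≈ 1# → (∀ z → P z → P (x * z)) → (∀ z → P z → P (y * z)) → x ^ n ≈ 1#
    scaling-invariant⇒^≈1 {n = n} {P} e e-injective e-onto e-into e≉0 x y xy≈1 x-into y-into =
      *-cancelˡ-nonzero (product e) _ _ (product-nonzero e e≉0) (begin
        product e * x ^ n                  ≈⟨ *-comm _ _ ⟩
        x ^ n * product e                  ≈⟨ *-congʳ (product-const n) ⟨
        product {n} (λ _ → x) * product e  ≈⟨ product-distrib (λ _ → x) e ⟨
        product (λ a → x * e a)            ≈⟨ product-cong (λ a → sym (proj₂ scaling a)) ⟩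
        product (λ a → e (π ⟨$⟩ʳ a))       ≈⟨ product-permute e π ⟨
        product e                          ≈⟨ *-identityʳ _ ⟨
        product e * 1#                     ∎)
      where
      x[yz]≈z : ∀ z → x * (y * z) ≈ z
      x[yz]≈z z = trans (sym (*-assoc x y z)) (trans (*-congʳ xy≈1) (*-identityˡ z))
      y[xz]≈z : ∀ z → y * (x * z) ≈ z
      y[xz]≈z z = trans (sym (*-assoc y x z)) (trans (*-congʳ (trans (*-comm y x) xy≈1)) (*-identityˡ z))
      scaling : Σ (Permutation n n) λ π → ∀ a → e (π ⟨$⟩ʳ a) ≈ x * e a
      scaling = permutation-of-enumeration e e-injective e-onto e-into (x *_) (y *_) *-congˡ *-congˡ
        x-into y-into x[yz]≈z y[xz]≈z
      π : Permutation n n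
      π = proj₁ scaling

    NonzeroSquare : Carrier → Set (c ⊔ ℓ)
    NonzeroSquare x = (¬ x ≈ 0#) × IsSquare R x

    nonzeroSquare-* : ∀ {x y} → NonzeroSquare x → NonzeroSquare y → NonzeroSquare (x * y)
    nonzeroSquare-* (x≉0 , u , uu≈x) (y≉0 , v , vv≈y) =
      *-nonzero x≉0 y≉0 , u * v ,
      trans (solve 2 (λ u v → (u :* v) :* (u :* v) := (u :* u) :* (v :* v)) refl u v) (*-cong uu≈x vv≈y)

    nonzeroSquare^≈1 : ∀ {n} (s : Fin n → Carrier) → (∀ a b → s a ≈ s b → a ≡ b) →
                       (∀ i → NonzeroSquare (s i)) →
                       (∀ x → ¬ x ≈ 0# → IsSquare R x → ∃ λ i → s i ≈ x) →
                       ∀ i → s i ^ n ≈ 1#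
    nonzeroSquare^≈1 s s-injective s-sq s-onto i with s-sq i
    ... | sᵢ≉0 , y , yy≈sᵢ =
      scaling-invariant⇒^≈1 s s-injective (λ x (x≉0 , x-sq) → s-onto x x≉0 x-sq) s-sq (λ a → proj₁ (s-sq a))
        (s i) (y ⁻¹ * y ⁻¹) sᵢy⁻²≈1 (λ _ → nonzeroSquare-* (s-sq i)) (λ _ → nonzeroSquare-* y⁻²-sq)
      where
      y≉0 : ¬ y ≈ 0#
      y≉0 y≈0 = sᵢ≉0 (trans (sym yy≈sᵢ) (trans (*-congʳ y≈0) (zeroˡ y)))
      yy⁻¹≈1 : y * y ⁻¹ ≈ 1#
      yy⁻¹≈1 = ⁻¹-inverse y y≉0
      sᵢy⁻²≈1 : s i * (y ⁻¹ * y ⁻¹) ≈ 1#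
      sᵢy⁻²≈1 = begin
        s i * (y ⁻¹ * y ⁻¹)      ≈⟨ *-congʳ yy≈sᵢ ⟨
        (y * y) * (y ⁻¹ * y ⁻¹)
          ≈⟨ solve 2 (λ a b → (a :* a) :* (b :* b) := (a :* b) :* (a :* b)) refl y (y ⁻¹) ⟩
        (y * y ⁻¹) * (y * y ⁻¹)  ≈⟨ *-cong yy⁻¹≈1 yy⁻¹≈1 ⟩
        1# * 1#                  ≈⟨ *-identityʳ 1# ⟩
        1#                       ∎
      y⁻¹≉0 : ¬ y ⁻¹ ≈ 0#
      y⁻¹≉0 y⁻¹≈0 = 1≉0 (trans (sym yy⁻¹≈1) (trans (*-congˡ y⁻¹≈0) (zeroʳ y)))
      y⁻²-sq : NonzeroSquare (y ⁻¹ * y ⁻¹)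
      y⁻²-sq = *-nonzero y⁻¹≉0 y⁻¹≉0 , y ⁻¹ , refl

    product-punchIn≈powQuotient :
      ∀ {m} r (s : Fin (suc m) → Carrier) → (∀ a b → s a ≈ s b → a ≡ b) → (∀ i → s i ^ suc m ≈ r) →
      ∀ j x → product (λ i → x - s (punchIn j i)) ≈ powQuotient (suc m) x (s j)
    product-punchIn≈powQuotient {m} r s s-injective sᵢ^≈r j =
      monic-agree (monic-product s′) (powQuotient-monic m (s j)) s′ s′-injective
        (λ i → trans (lhs≈0 i) (sym (rhs≈0 i)))
      where
      s′ : Fin m → Carrier
      s′ i = s (punchIn j i)
      s′-injective : ∀ a b → s′ a ≈ s′ b → a ≡ b
      s′-injective a b s′a≈s′b = punchIn-injective j a b (s-injective _ _ s′a≈s′b)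
      lhs≈0 : ∀ i → product (λ k → s′ i - s′ k) ≈ 0#
      lhs≈0 i = product≈0 (λ k → s′ i - s′ k) i (-‿inverseʳ (s′ i))
      rhs≈0 : ∀ i → powQuotient (suc m) (s′ i) (s j) ≈ 0#
      rhs≈0 i = x*y≈0⇒y≈0 s′ᵢ-sⱼ≉0 (identityʳ-unique (s j ^ suc m) _ (begin
        s j ^ suc m + (s′ i - s j) * powQuotient (suc m) (s′ i) (s j)  ≈⟨ powQuotient-spec (suc m) (s′ i) (s j) ⟨
        s′ i ^ suc m                                                   ≈⟨ sᵢ^≈r (punchIn j i) ⟩
        r                                                              ≈⟨ sᵢ^≈r j ⟨
        s j ^ suc m                                                    ∎))
        where
        s′ᵢ-sⱼ≉0 : ¬ s′ i - s j ≈ 0#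
        s′ᵢ-sⱼ≉0 s′ᵢ-sⱼ≈0 = punchInᵢ≢i j i (s-injective _ _ (x∙y⁻¹≈ε⇒x≈y _ _ s′ᵢ-sⱼ≈0))

    orderedDiffs-of-roots-of-unity :
      ∀ k (s : Fin (suc (suc k)) → Carrier) → (∀ a b → s a ≈ s b → a ≡ b) →
      s zero ≈ 1# → (∀ i → s i ^ suc (suc k) ≈ 1#) →
      (suc (suc k) · 1#) * orderedDiffs (λ i → s (suc i)) ≈ (suc (suc k) · 1#) ^ suc k
    orderedDiffs-of-roots-of-unity k s s-injective s₀≈1 s^≈1 = begin
      ν * orderedDiffs t                                ≈⟨ *-identityˡ _ ⟨
      1# * (ν * orderedDiffs t)                         ≈⟨ *-congʳ u∏t≈1 ⟨
      (u * product t) * (ν * orderedDiffs t)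
        ≈⟨ solve 4 (λ u p ν e → (u :* p) :* (ν :* e) := ((u :* ν) :* e) :* p) refl u (product t) ν (orderedDiffs t) ⟩
      ((u * ν) * orderedDiffs t) * product t            ≈⟨ *-congʳ (*-congʳ ∏[t-1]≈uν) ⟨
      (product (λ j → t j - 1#) * orderedDiffs t) * product t
        ≈⟨ *-congʳ (product-distrib (λ j → t j - 1#) Eⱼ) ⟨
      product (λ j → (t j - 1#) * Eⱼ j) * product t     ≈⟨ product-distrib (λ j → (t j - 1#) * Eⱼ j) t ⟨
      product (λ j → ((t j - 1#) * Eⱼ j) * t j)         ≈⟨ product-cong [tⱼ-1]Eⱼtⱼ≈ν ⟩
      product {suc k} (λ _ → ν)                         ≈⟨ product-const (suc k) ⟩
      ν ^ suc k                                         ∎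
      where
      N : ℕ
      N = suc (suc k)
      ν u : Carrier
      ν = N · 1#
      u = (- 1#) ^ suc k
      t : Fin (suc k) → Carrier
      t i = s (suc i)
      Eⱼ : Fin (suc k) → Carrier
      Eⱼ j = product (λ i → t j - t (punchIn j i))
      factor : ∀ j x → product (λ i → x - s (punchIn j i)) ≈ powQuotient N x (s j)
      factor = product-punchIn≈powQuotient 1# s s-injective s^≈1
      u∏t≈1 : u * product t ≈ 1#
      u∏t≈1 = begin
        u * product t              ≈⟨ product-neg t ⟨
        product (λ i → - t i)      ≈⟨ product-cong (λ i → +-identityˡ (- t i)) ⟨
        product (λ i → 0# - t i)   ≈⟨ factor zero 0# ⟩
        powQuotient N 0# (s zero)  ≈⟨ powQuotient-at-0 (suc k) (s zero) ⟩
        s zero ^ suc k             ≈⟨ ^-congˡ (suc k) s₀≈1 ⟩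
        1# ^ suc k                 ≈⟨ 1^≈1 (suc k) ⟩
        1#                         ∎
      ∏[t-1]≈uν : product (λ j → t j - 1#) ≈ u * ν
      ∏[t-1]≈uν = begin
        product (λ j → t j - 1#)             ≈⟨ product-cong (λ j → ⁻¹-anti-homo‿- 1# (t j)) ⟨
        product (λ j → - (1# - t j))         ≈⟨ product-neg (λ j → 1# - t j) ⟩
        u * product (λ j → 1# - t j)         ≈⟨ *-congˡ (product-cong (λ j → +-congʳ { - t j} s₀≈1)) ⟨
        u * product (λ j → s zero - t j)     ≈⟨ *-congˡ (factor zero (s zero)) ⟩
        u * powQuotient N (s zero) (s zero)  ≈⟨ *-congˡ (powQuotient-diagonal (suc k) (s zero)) ⟩
        u * (N · s zero ^ suc k)
          ≈⟨ *-congˡ (×-congʳ N (trans (^-congˡ (suc k) s₀≈1) (1^≈1 (suc k)))) ⟩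
        u * ν                                ∎
      -- punchIn (suc j) fixes zero, so factor (suc j) splits off t j - s zero from Eⱼ j.
      [tⱼ-1]Eⱼtⱼ≈ν : ∀ j → ((t j - 1#) * Eⱼ j) * t j ≈ ν
      [tⱼ-1]Eⱼtⱼ≈ν j = begin
        ((t j - 1#) * Eⱼ j) * t j      ≈⟨ *-congʳ (*-congʳ (+-congˡ (-‿cong s₀≈1))) ⟨
        ((t j - s zero) * Eⱼ j) * t j  ≈⟨ *-congʳ (factor (suc j) (t j)) ⟩
        powQuotient N (t j) (t j) * t j  ≈⟨ *-congʳ (powQuotient-diagonal (suc k) (t j)) ⟩
        (N · t j ^ suc k) * t j        ≈⟨ ×-assoc-* N (t j ^ suc k) (t j) ⟩
        N · (t j ^ suc k * t j)        ≈⟨ ×-congʳ N (trans (*-comm _ _) (s^≈1 (suc j))) ⟩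
        ν                              ∎

    [2n+1]·1≈0⇒n·1≈-½ : ∀ n → (2 ℕ.* n ℕ.+ 1) · 1# ≈ 0# →
                        (¬ n · 1# ≈ 0#) × (n · 1# ≈ - (1# + 1#) ⁻¹)
    [2n+1]·1≈0⇒n·1≈-½ n [2n+1]·1≈0 =
      x*y+1≈0⇒y≉0 two*ν+1≈0 , *-cancelˡ-nonzero two ν (- two ⁻¹) two≉0 (begin
      two * ν           ≈⟨ inverseˡ-unique _ _ two*ν+1≈0 ⟩
      - 1#              ≈⟨ -‿cong (⁻¹-inverse two two≉0) ⟨
      - (two * two ⁻¹)  ≈⟨ -‿distribʳ-* two (two ⁻¹) ⟩
      two * - two ⁻¹    ∎)
      where
      two ν : Carrier
      two = 1# + 1#
      ν = n · 1#
      two*ν+1≈0 : two * ν + 1# ≈ 0#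
      two*ν+1≈0 = begin
        two * ν + 1#             ≈⟨ +-cong (*-congʳ (+-congˡ (+-identityʳ 1#))) (+-identityʳ 1#) ⟨
        (2 · 1#) * ν + 1 · 1#    ≈⟨ +-congʳ (×1-homo-* 2 n) ⟨
        (2 ℕ.* n) · 1# + 1 · 1#  ≈⟨ ×-homo-+ 1# (2 ℕ.* n) 1 ⟨
        (2 ℕ.* n ℕ.+ 1) · 1#     ≈⟨ [2n+1]·1≈0 ⟩
        0#                       ∎
      x*y+1≈0⇒y≉0 : ∀ {x y} → x * y + 1# ≈ 0# → ¬ y ≈ 0#
      x*y+1≈0⇒y≉0 {x} {y} xy+1≈0 y≈0 = 1≉0 (begin
        1#          ≈⟨ +-identityˡ 1# ⟨
        0# + 1#     ≈⟨ +-congʳ (trans (*-congˡ y≈0) (zeroʳ x)) ⟨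
        x * y + 1#  ≈⟨ xy+1≈0 ⟩
        0#          ∎)
      two≉0 : ¬ two ≈ 0#
      two≉0 = x*y+1≈0⇒y≉0 (trans (+-congʳ (*-comm ν two)) two*ν+1≈0)

    discProd-of-nonzeroSquares :
      ∀ m (s : Fin (suc (suc m)) → Carrier) → s zero ≈ 1# → (∀ a b → s a ≈ s b → a ≡ b) →
      (∀ i → NonzeroSquare (s i)) → (∀ x → ¬ x ≈ 0# → IsSquare R x → ∃ λ i → s i ≈ x) →
      (2 ℕ.* suc (suc m) ℕ.+ 1) · 1# ≈ 0# →
      pow R (- 1#) ((suc m ℕ.* m) ℕ./ 2) * discProd R s ≈ pow R (- (1# + 1#) ⁻¹) m
    discProd-of-nonzeroSquares m s s₀≈1 s-injective s-sq s-onto [2n+1]·1≈0 = begin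
      pow R (- 1#) ((suc m ℕ.* m) ℕ./ 2) * discProd R s
        ≈⟨ *-cong (reflexive sign≡) (discProd≈discriminant s) ⟩
      (- 1#) ^ (suc m C 2) * discriminant t  ≈⟨ orderedDiffs≈±discriminant m t ⟨
      orderedDiffs t                         ≈⟨ *-cancelˡ-nonzero ν _ _ ν≉0 νE≈ν^[1+m] ⟩
      ν ^ m                                  ≈⟨ ^-congˡ m ν≈-½ ⟩
      (- (1# + 1#) ⁻¹) ^ m                   ≡⟨ pow≡^ _ m ⟨
      pow R (- (1# + 1#) ⁻¹) m               ∎
      where
      t : Fin (suc m) → Carrier
      t i = s (suc i)
      ν : Carrier
      ν = suc (suc m) · 1#
      sign≡ : pow R (- 1#) ((suc m ℕ.* m) ℕ./ 2) ≡ (- 1#) ^ (suc m C 2)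
      sign≡ = ≡.trans (pow≡^ (- 1#) ((suc m ℕ.* m) ℕ./ 2)) (≡.cong ((- 1#) ^_) ([1+m]*m/2≡[1+m]C2 m))
      ν≉0 : ¬ ν ≈ 0#
      ν≉0 = proj₁ ([2n+1]·1≈0⇒n·1≈-½ (suc (suc m)) [2n+1]·1≈0)
      ν≈-½ : ν ≈ - (1# + 1#) ⁻¹
      ν≈-½ = proj₂ ([2n+1]·1≈0⇒n·1≈-½ (suc (suc m)) [2n+1]·1≈0)
      νE≈ν^[1+m] : ν * orderedDiffs t ≈ ν ^ suc m
      νE≈ν^[1+m] = orderedDiffs-of-roots-of-unity m s s-injective s₀≈1
        (nonzeroSquare^≈1 s s-injective s-sq s-onto)

open import Data.Nat using (_+_; _*_; _∸_; _^_; _≤_; _/_; s≤s)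
open import Data.Nat.Primality using (Prime)

lemma2p1 : ∀ {c ℓ} (R : CommutativeRing c ℓ) (F : IsField R)
    (p f n q : ℕ) → Prime p → 1 ≤ f → q ≡ p ^ f → q ≡ 2 * n + 1 → 5 ≤ q →
    HasCardinality R q →
    (s : Fin n → CommutativeRing.Carrier R) →
    (∀ i → toℕ i ≡ 0 → CommutativeRing._≈_ R (s i) (CommutativeRing.1# R)) →
    (∀ i j → CommutativeRing._≈_ R (s i) (s j) → i ≡ j) →
    (∀ i → (¬ CommutativeRing._≈_ R (s i) (CommutativeRing.0# R)) × IsSquare R (s i)) →
    (∀ x → ¬ CommutativeRing._≈_ R x (CommutativeRing.0# R) → IsSquare R x →
      ∃ λ i → CommutativeRing._≈_ R (s i) x) →
    CommutativeRing._≈_ R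
      (CommutativeRing._*_ R
        (pow R (CommutativeRing.-_ R (CommutativeRing.1# R)) (((n ∸ 1) * (n ∸ 2)) / 2))
        (discProd R s))
      (pow R (CommutativeRing.-_ R (IsField._⁻¹ F
         (CommutativeRing._+_ R (CommutativeRing.1# R) (CommutativeRing.1# R)))) (n ∸ 2))
lemma2p1 R F _ _ zero          _ _ _ _ ≡.refl (s≤s ())             _ _ _ _ _ _
lemma2p1 R F _ _ (suc zero)    _ _ _ _ ≡.refl (s≤s (s≤s (s≤s ()))) _ _ _ _ _ _
lemma2p1 R F _ _ (suc (suc m)) _ _ _ _ ≡.refl _ card s s₀≈1 s-injective s-sq s-onto =
  discProd-of-nonzeroSquares R F m s (s₀≈1 zero ≡.refl) s-injective s-sq s-onto (cardinality·1≈0 R card)
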